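{- The relation $\leq_S$ is transitive: if $H\leq_S K$ and $K\leq_S G$ then $H\leq_S G$. Consequently $\leq_S$ is a partial order on isomorphism classes of graphs, refining the partial order $\leq_R$.
   Context: All graphs are finite directed graphs with state set $V(G)$, edge set $E(G)$, source/target maps $s,t$; loops and parallel edges allowed; all graphs sink-free. $E_I(G)=s^{ -1}(I)$, $L_I(G)$ finite edge paths starting at $I$. A homomorphism consists of maps on edges and ($\partial\Phi$) on states commuting with $s,t$. A right-resolver is a surjective homomorphism with $\Phi|_{E_I(G)}:E_I(G)\to E_{\partial\Phi(I)}(H)$ bijective for all $I$; $H\leq_R G$ if a right-resolver $G\to H$ exists; $\leq_R$ is a partial order on isomorphism classes of graphs. For a right-resolver $\Phi:G\to H$ and $u\in L_{\partial\Phi(I)}(H)$, $I\cdot u$ is the endpoint of the unique lift of $u$ from $I$; $I_1\sim_\Phi I_2$ iff $\partial\Phi(I_1)=\partial\Phi(I_2)=:I$ and for every $u\in L_I(H)$ there is $v\in L_{t(u)}(H)$ with $I_1\cdot uv=I_2\cdot uv$. $\Phi$ is synchronizing if each fiber $(\partial\Phi)^{ -1}(I)$ is a single $\sim_\Phi$ class, and $H\leq_S G$ if a synchronizing right-resolver $G\to H$ exists. -}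

module Defs where

open import Data.Nat using (ℕ)
open import Data.Fin using (Fin)
open import Data.List using (List; []; _∷_; _++_; map)
open import Data.Product using (Σ; _×_; _,_; proj₁; proj₂)
open import Data.Unit using (⊤; tt)
open import Relation.Binary.PropositionalEquality using (_≡_; refl; sym; trans; cong)
open import Function.Definitions using (Surjective; Injective; Bijective)

record Graph : Set where
  field
    nV nE    : ℕ
    src tgt  : Fin nE → Fin nV
    sinkFree : ∀ (v : Fin nV) → Σ (Fin nE) λ e → src e ≡ v
open Graph public

record Hom (G H : Graph) : Set where
  field
    edgeMap  : Fin (nE G) → Fin (nE H)
    stateMap : Fin (nV G) → Fin (nV H)
    srcComm  : ∀ e → src H (edgeMap e) ≡ stateMap (src G e)
    tgtComm  : ∀ e → tgt H (edgeMap e) ≡ stateMap (tgt G e)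
open Hom public

-- Right-resolver: surjective homomorphism such that for every state I the
-- restriction Φ : E_I(G) → E_{∂Φ(I)}(H) is bijective
-- (injective: locInj; surjective: locSurj).
record RightResolver (G H : Graph) : Set where
  field
    hom      : Hom G H
    surjE    : Surjective _≡_ _≡_ (edgeMap hom)
    surjV    : Surjective _≡_ _≡_ (stateMap hom)
    locInj   : ∀ (e e' : Fin (nE G)) → src G e ≡ src G e' →
               edgeMap hom e ≡ edgeMap hom e' → e ≡ e'
    locSurj  : ∀ (I : Fin (nV G)) (f : Fin (nE H)) → src H f ≡ stateMap hom I →
               Σ (Fin (nE G)) λ e → (src G e ≡ I) × (edgeMap hom e ≡ f)
open RightResolver public

_≤R_ : Graph → Graph → Set
H ≤R G = RightResolver G H

ValidFrom : (G : Graph) → Fin (nV G) → List (Fin (nE G)) → Set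
ValidFrom G I []      = ⊤
ValidFrom G I (e ∷ w) = (src G e ≡ I) × ValidFrom G (tgt G e) w

endpoint : (G : Graph) → Fin (nV G) → List (Fin (nE G)) → Fin (nV G)
endpoint G I []      = I
endpoint G I (e ∷ w) = endpoint G (tgt G e) w

++-valid : (G : Graph) (I : Fin (nV G)) (u v : List (Fin (nE G))) →
           ValidFrom G I u → ValidFrom G (endpoint G I u) v →
           ValidFrom G I (u ++ v)
++-valid G I []      v _          vv = vv
++-valid G I (e ∷ u) v (se , vu)  vv = se , ++-valid G (tgt G e) u v vu vv

-- I · u : the endpoint of the unique lift, starting at I, of a path u in H
-- starting at J = ∂Φ(I).
lift : {G H : Graph} (Φ : RightResolver G H) (I : Fin (nV G)) (J : Fin (nV H)) →
       stateMap (hom Φ) I ≡ J → (u : List (Fin (nE H))) → ValidFrom H J u →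
       Fin (nV G)
lift Φ I J eq []      _         = I
lift {G} {H} Φ I J eq (f ∷ u) (sf , vu) with locSurj Φ I f (trans sf (sym eq))
... | e , se , Φe =
  lift Φ (tgt G e) (tgt H f)
       (trans (sym (tgtComm (hom Φ) e)) (cong (tgt H) Φe)) u vu

-- I₁ ∼_Φ I₂ : same fiber over I := ∂Φ(I₁), and for every u ∈ L_I(H) there is
-- v ∈ L_{t(u)}(H) with I₁ · uv = I₂ · uv.
Related : {G H : Graph} (Φ : RightResolver G H) → Fin (nV G) → Fin (nV G) → Set
Related {G} {H} Φ I₁ I₂ =
  Σ (stateMap (hom Φ) I₁ ≡ stateMap (hom Φ) I₂) λ eq →
    ∀ (u : List (Fin (nE H))) (vu : ValidFrom H (stateMap (hom Φ) I₁) u) →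
      Σ (List (Fin (nE H))) λ v →
      Σ (ValidFrom H (endpoint H (stateMap (hom Φ) I₁) u) v) λ vv →
        lift Φ I₁ (stateMap (hom Φ) I₁) refl (u ++ v)
             (++-valid H (stateMap (hom Φ) I₁) u v vu vv)
        ≡ lift Φ I₂ (stateMap (hom Φ) I₁) (sym eq) (u ++ v)
             (++-valid H (stateMap (hom Φ) I₁) u v vu vv)

Synchronizing : {G H : Graph} → RightResolver G H → Set
Synchronizing {G} Φ = ∀ (I₁ I₂ : Fin (nV G)) →
  stateMap (hom Φ) I₁ ≡ stateMap (hom Φ) I₂ → Related Φ I₁ I₂

_≤S_ : Graph → Graph → Set
H ≤S G = Σ (RightResolver G H) Synchronizing

record Iso (G H : Graph) : Set where
  field
    isoHom : Hom G H
    bijE   : Bijective _≡_ _≡_ (edgeMap isoHom)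
    bijV   : Bijective _≡_ _≡_ (stateMap isoHom)

-- Paths lift uniquely along a right-resolver, so Φ is synchronizing as soon as
-- any two states I₁, I₂ of a fibre are synchronized by some word v of H,
-- i.e. the lifts of v from I₁ and from I₂ end at the same state (for a general
-- prefix u, apply this to I₁ · u and I₂ · u, which again share a fibre).
-- For a composite G →Ψ K →Φ H, first synchronize ∂Ψ I₁ and ∂Ψ I₂ by a word v
-- using Φ; the lifts of v from I₁ and I₂ then end in a common Ψ-fibre, where
-- Ψ synchronizes them by some word k, so v followed by Φ k synchronizes I₁, I₂.
-- Antisymmetry is a counting argument: between finite sets, surjections in
-- both directions are bijections.
module Submission where

open import Defs
open import Data.Nat using (suc; _≤_)
open import Data.Nat.Properties using (≤-trans; 1+n≰n)
open import Data.Fin using (Fin; punchIn; punchOut)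
open import Data.Fin.Properties using (_≟_; injective⇒≤; punchIn-punchOut)
open import Data.List using (List; []; _∷_; _++_; map)
open import Data.List.Properties using (map-∘; map-++; ∷-injectiveˡ; ∷-injectiveʳ)
open import Data.Product using (Σ; _×_; _,_; proj₁; proj₂)
open import Data.Unit using (tt)
open import Function.Base using (_∘_)
open import Function.Bundles using (mk⤖; Inverse; Bijection)
open import Function.Definitions using (Surjective; Injective; Bijective)
open import Function.Properties.Bijection using (⤖⇒↔)
open import Function.Properties.Inverse using (↔-sym; ↔⇒⤖)
import Function.Construct.Composition as Compose
open import Relation.Binary.PropositionalEquality
  using (_≡_; _≢_; refl; sym; trans; cong; cong₂; subst; module ≡-Reasoning)
open import Relation.Nullary using (yes; no; contradiction)

private
  variable
    G H K : Graph

endpoint-++ : ∀ (G : Graph) I (u v : List (Fin (nE G))) →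
              endpoint G I (u ++ v) ≡ endpoint G (endpoint G I u) v
endpoint-++ G I []      v = refl
endpoint-++ G I (e ∷ u) v = endpoint-++ G (tgt G e) u v

map-valid : (h : Hom G H) {I : Fin (nV G)} {J : Fin (nV H)} → stateMap h I ≡ J →
            ∀ {w} → ValidFrom G I w → ValidFrom H J (map (edgeMap h) w)
map-valid h I↦J {[]}    _         = tt
map-valid h I↦J {e ∷ w} (refl , vw) =
  trans (srcComm h e) I↦J , map-valid h (sym (tgtComm h e)) vw

map-endpoint : (h : Hom G H) (I : Fin (nV G)) (w : List (Fin (nE G))) →
               stateMap h (endpoint G I w) ≡
               endpoint H (stateMap h I) (map (edgeMap h) w)
map-endpoint h I []      = refl
map-endpoint h I (e ∷ w) rewrite tgtComm h e = map-endpoint h _ w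

record PathOver (Φ : RightResolver G H) (I : Fin (nV G))
                (u : List (Fin (nE H))) : Set where
  constructor pathOver
  field
    path  : List (Fin (nE G))
    valid : ValidFrom G I path
    label : map (edgeMap (hom Φ)) path ≡ u

  end : Fin (nV G)
  end = endpoint G I path
open PathOver

module _ (Φ : RightResolver G H) where

  private
    ∂Φ = stateMap (hom Φ)

  liftPath : ∀ {I J} → ∂Φ I ≡ J → ∀ {u} → ValidFrom H J u → PathOver Φ I u
  liftPath         I↦J {[]}    _          = pathOver [] _ refl
  liftPath {I = I} I↦J {f ∷ u} (sf , vu) with locSurj Φ I f (trans sf (sym I↦J))
  ... | e , se , e↦f =
    let pathOver w vw w↦u = liftPath (trans (sym (tgtComm (hom Φ) e)) (cong (tgt H) e↦f)) vu
    in pathOver (e ∷ w) (se , vw) (cong₂ _∷_ e↦f w↦u)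

  end≡lift : ∀ {I J} (I↦J : ∂Φ I ≡ J) {u} (vu : ValidFrom H J u)
                  (p : PathOver Φ I u) → end p ≡ lift Φ I J I↦J u vu
  end≡lift I↦J {[]} vu (pathOver [] _ _) = refl
  end≡lift {I} I↦J {f ∷ u} (sf , vu) (pathOver (e ∷ w) (se , vw) e∷w↦f∷u)
    with locSurj Φ I f (trans sf (sym I↦J))
  ... | e₀ , se₀ , e₀↦f
    with locInj Φ e e₀ (trans se (sym se₀)) (trans (∷-injectiveˡ e∷w↦f∷u) (sym e₀↦f))
  ... | refl = end≡lift _ vu (pathOver w vw (∷-injectiveʳ e∷w↦f∷u))

  stateMap-end : ∀ {I J} → ∂Φ I ≡ J → ∀ {u} (p : PathOver Φ I u) →
                  ∂Φ (end p) ≡ endpoint H J u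
  stateMap-end refl (pathOver w _ refl) = map-endpoint (hom Φ) _ w

  label-valid : ∀ {I J} → ∂Φ I ≡ J → ∀ {u} → PathOver Φ I u → ValidFrom H J u
  label-valid I↦J (pathOver _ vw refl) = map-valid (hom Φ) I↦J vw

_++ᴾ_ : {Φ : RightResolver G H} {I : Fin (nV G)} {u v : List (Fin (nE H))} →
        (p : PathOver Φ I u) → PathOver Φ (end p) v → PathOver Φ I (u ++ v)
_++ᴾ_ {Φ = Φ} (pathOver w vw w↦u) (pathOver w′ vw′ w′↦v) =
  pathOver (w ++ w′) (++-valid _ _ w w′ vw vw′)
           (trans (map-++ (edgeMap (hom Φ)) w w′) (cong₂ _++_ w↦u w′↦v))

record Synchronized (Φ : RightResolver G H) (I₁ I₂ : Fin (nV G)) : Set where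
  field
    word  : List (Fin (nE H))
    over₁ : PathOver Φ I₁ word
    over₂ : PathOver Φ I₂ word
    meet  : end over₁ ≡ end over₂
open Synchronized

FibresSynchronized : RightResolver G H → Set
FibresSynchronized {G} Φ = ∀ (I₁ I₂ : Fin (nV G)) →
  stateMap (hom Φ) I₁ ≡ stateMap (hom Φ) I₂ → Synchronized Φ I₁ I₂

module _ {Φ : RightResolver G H} where

  synchronized-refl : ∀ {I} → Synchronized Φ I I
  synchronized-refl = record
    { word = [] ; over₁ = pathOver [] _ refl ; over₂ = pathOver [] _ refl ; meet = refl }

  synchronized-prepend : ∀ {I₁ I₂ u} (p₁ : PathOver Φ I₁ u) (p₂ : PathOver Φ I₂ u) →
                         Synchronized Φ (end p₁) (end p₂) → Synchronized Φ I₁ I₂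
  synchronized-prepend p₁ p₂ s = record
    { word  = _
    ; over₁ = p₁ ++ᴾ over₁ s
    ; over₂ = p₂ ++ᴾ over₂ s
    ; meet  = begin
        end (p₁ ++ᴾ over₁ s) ≡⟨ endpoint-++ G _ (path p₁) (path (over₁ s)) ⟩
        end (over₁ s)        ≡⟨ meet s ⟩
        end (over₂ s)        ≡⟨ endpoint-++ G _ (path p₂) (path (over₂ s)) ⟨
        end (p₂ ++ᴾ over₂ s) ∎
    }
    where open ≡-Reasoning

synchronizing⇒fibresSynchronized : (Φ : RightResolver G H) →
                                   Synchronizing Φ → FibresSynchronized Φ
synchronizing⇒fibresSynchronized Φ sync I₁ I₂ I₁~I₂ with sync I₁ I₂ I₁~I₂
... | I₁~I₂′ , synchronizes with synchronizes [] tt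
... | v , vv , I₁v≡I₂v = record
  { word  = v
  ; over₁ = p₁
  ; over₂ = p₂
  ; meet  = trans (end≡lift Φ refl vv p₁)
              (trans I₁v≡I₂v (sym (end≡lift Φ (sym I₁~I₂′) vv p₂)))
  }
  where
  p₁ = liftPath Φ refl vv
  p₂ = liftPath Φ (sym I₁~I₂′) vv

fibresSynchronized⇒synchronizing : (Φ : RightResolver G H) →
                                   FibresSynchronized Φ → Synchronizing Φ
fibresSynchronized⇒synchronizing {H = H} Φ sync I₁ I₂ I₁~I₂ = I₁~I₂ , λ u vu →
  let p₁ = liftPath Φ refl vu
      p₂ = liftPath Φ (sym I₁~I₂) vu
      ends-related = trans (stateMap-end Φ refl p₁)
                           (sym (stateMap-end Φ (sym I₁~I₂) p₂))
      t  = sync (end p₁) (end p₂) ends-related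
      s  = synchronized-prepend p₁ p₂ t
      vv = label-valid Φ (stateMap-end Φ refl p₁) (over₁ t)
      vuv = ++-valid H _ u _ vu vv
  in _ , vv ,
     trans (sym (end≡lift Φ refl vuv (over₁ s)))
           (trans (meet s) (end≡lift Φ (sym I₁~I₂) vuv (over₂ s)))

injective⇒synchronizing : (Φ : RightResolver G H) →
                          Injective _≡_ _≡_ (stateMap (hom Φ)) → Synchronizing Φ
injective⇒synchronizing Φ inj = fibresSynchronized⇒synchronizing Φ λ I₁ I₂ I₁~I₂ →
  subst (Synchronized Φ I₁) (inj I₁~I₂) synchronized-refl

_∘ᴴ_ : Hom K H → Hom G K → Hom G H
φ ∘ᴴ ψ = record
  { edgeMap  = edgeMap φ ∘ edgeMap ψ
  ; stateMap = stateMap φ ∘ stateMap ψ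
  ; srcComm  = λ e → trans (srcComm φ (edgeMap ψ e)) (cong (stateMap φ) (srcComm ψ e))
  ; tgtComm  = λ e → trans (tgtComm φ (edgeMap ψ e)) (cong (stateMap φ) (tgtComm ψ e))
  }

_∘ᴿ_ : RightResolver K H → RightResolver G K → RightResolver G H
_∘ᴿ_ {K} {H} {G} Φ Ψ = record
  { hom     = hom Φ ∘ᴴ hom Ψ
  ; surjE   = Compose.surjective _≡_ _≡_ _≡_ (surjE Ψ) (surjE Φ)
  ; surjV   = Compose.surjective _≡_ _≡_ _≡_ (surjV Ψ) (surjV Φ)
  ; locInj  = λ e e′ se≡se′ →
      locInj Ψ e e′ se≡se′ ∘
      locInj Φ _ _ (trans (srcComm (hom Ψ) e)
                     (trans (cong (stateMap (hom Ψ)) se≡se′) (sym (srcComm (hom Ψ) e′))))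
  ; locSurj = locSurj-∘
  }
  where
  locSurj-∘ : ∀ I f → src H f ≡ stateMap (hom Φ) (stateMap (hom Ψ) I) →
              Σ (Fin (nE G)) λ e → (src G e ≡ I) × (edgeMap (hom Φ) (edgeMap (hom Ψ) e) ≡ f)
  locSurj-∘ I f sf with locSurj Φ (stateMap (hom Ψ) I) f sf
  ... | d , sd , d↦f with locSurj Ψ I d sd
  ... | e , se , e↦d = e , se , trans (cong (edgeMap (hom Φ)) e↦d) d↦f

pathOver-∘ : (Φ : RightResolver K H) {Ψ : RightResolver G K} {I : Fin (nV G)}
             {k : List (Fin (nE K))} {v : List (Fin (nE H))} →
             PathOver Ψ I k → map (edgeMap (hom Φ)) k ≡ v → PathOver (Φ ∘ᴿ Ψ) I v
pathOver-∘ Φ (pathOver w vw w↦k) k↦v =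
  pathOver w vw (trans (map-∘ w) (trans (cong (map (edgeMap (hom Φ))) w↦k) k↦v))

synchronized-∘ : (Φ : RightResolver K H) {Ψ : RightResolver G K} {I₁ I₂ : Fin (nV G)} →
                 Synchronized Ψ I₁ I₂ → Synchronized (Φ ∘ᴿ Ψ) I₁ I₂
synchronized-∘ Φ s = record
  { word  = map (edgeMap (hom Φ)) (word s)
  ; over₁ = pathOver-∘ Φ (over₁ s) refl
  ; over₂ = pathOver-∘ Φ (over₂ s) refl
  ; meet  = meet s
  }

fibresSynchronized-∘ : (Φ : RightResolver K H) (Ψ : RightResolver G K) →
                       FibresSynchronized Φ → FibresSynchronized Ψ →
                       FibresSynchronized (Φ ∘ᴿ Ψ)
fibresSynchronized-∘ Φ Ψ syncΦ syncΨ I₁ I₂ I₁~I₂ =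
  synchronized-prepend (pathOver-∘ Φ q₁ (label (over₁ s)))
                       (pathOver-∘ Φ q₂ (label (over₂ s)))
                       (synchronized-∘ Φ (syncΨ (end q₁) (end q₂) ends-related))
  where
  s  = syncΦ _ _ I₁~I₂
  q₁ = liftPath Ψ refl (valid (over₁ s))
  q₂ = liftPath Ψ refl (valid (over₂ s))
  ends-related : stateMap (hom Ψ) (end q₁) ≡ stateMap (hom Ψ) (end q₂)
  ends-related = trans (stateMap-end Ψ refl q₁)
                       (trans (meet s) (sym (stateMap-end Ψ refl q₂)))

Iso⇒RightResolver : Iso G H → RightResolver G H
Iso⇒RightResolver {G} {H} i = record
  { hom     = h
  ; surjE   = proj₂ (bijE i)
  ; surjV   = proj₂ (bijV i)
  ; locInj  = λ _ _ _ → proj₁ (bijE i)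
  ; locSurj = locSurj-iso
  }
  where
  open Iso
  h = isoHom i
  locSurj-iso : ∀ I f → src H f ≡ stateMap h I →
                Σ (Fin (nE G)) λ e → (src G e ≡ I) × (edgeMap h e ≡ f)
  locSurj-iso I f sf with proj₂ (bijE i) f
  ... | e , e↦f = e , proj₁ (bijV i) (trans (sym (srcComm h e)) (trans (cong (src H) (e↦f refl)) sf))
                    , e↦f refl

bijective⇒inverse : ∀ {a b} {f : Fin a → Fin b} → Bijective _≡_ _≡_ f →
                    Σ (Fin b → Fin a) λ g → (∀ y → f (g y) ≡ y) × Bijective _≡_ _≡_ g
bijective⇒inverse bij =
  Inverse.from i , Inverse.strictlyInverseˡ i , Bijection.bijective (↔⇒⤖ (↔-sym i))
  where i = ⤖⇒↔ (mk⤖ bij)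

Iso-sym : Iso G H → Iso H G
Iso-sym {G} {H} i = record
  { isoHom = record
    { edgeMap  = from-E
    ; stateMap = from-V
    ; srcComm  = λ f → commutes (src G) (src H) (srcComm h) f
    ; tgtComm  = λ f → commutes (tgt G) (tgt H) (tgtComm h) f
    }
  ; bijE = proj₂ (proj₂ (bijective⇒inverse (Iso.bijE i)))
  ; bijV = proj₂ (proj₂ (bijective⇒inverse (Iso.bijV i)))
  }
  where
  h = Iso.isoHom i
  from-E = proj₁ (bijective⇒inverse (Iso.bijE i))
  from-V = proj₁ (bijective⇒inverse (Iso.bijV i))
  to-from-E = proj₁ (proj₂ (bijective⇒inverse (Iso.bijE i)))
  to-from-V = proj₁ (proj₂ (bijective⇒inverse (Iso.bijV i)))
  commutes : (σ : Fin (nE G) → Fin (nV G)) (τ : Fin (nE H) → Fin (nV H)) →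
             (∀ e → τ (edgeMap h e) ≡ stateMap h (σ e)) →
             ∀ f → σ (from-E f) ≡ from-V (τ f)
  commutes σ τ comm f = proj₁ (Iso.bijV i) (begin
    stateMap h (σ (from-E f))    ≡⟨ comm (from-E f) ⟨
    τ (edgeMap h (from-E f))     ≡⟨ cong τ (to-from-E f) ⟩
    τ f                          ≡⟨ to-from-V (τ f) ⟨
    stateMap h (from-V (τ f))    ∎)
    where open ≡-Reasoning

Iso-refl : (G : Graph) → Iso G G
Iso-refl G = record
  { isoHom = record { edgeMap = λ e → e ; stateMap = λ I → I ; srcComm = λ _ → refl ; tgtComm = λ _ → refl }
  ; bijE   = (λ eq → eq) , (λ f → f , λ eq → eq)
  ; bijV   = (λ eq → eq) , (λ I → I , λ eq → eq)
  }

Iso⇒≤S : Iso G H → H ≤S G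
Iso⇒≤S i = Iso⇒RightResolver i , injective⇒synchronizing _ (proj₁ (Iso.bijV i))

surjective⇒≤ : ∀ {m n} {f : Fin m → Fin n} → Surjective _≡_ _≡_ f → n ≤ m
surjective⇒≤ {f = f} sur = injective⇒≤ {f = section} λ {y₁} {y₂} eq →
  trans (sym (proj₂ (sur y₁) refl)) (trans (cong f eq) (proj₂ (sur y₂) refl))
  where
  section = λ y → proj₁ (sur y)

surjective-∘-punchIn : ∀ {m n} {f : Fin (suc m) → Fin n} {x y} → y ≢ x → f x ≡ f y →
                       Surjective _≡_ _≡_ f → Surjective _≡_ _≡_ (f ∘ punchIn y)
surjective-∘-punchIn {f = f} {x} {y} y≢x fx≡fy sur z with proj₁ (sur z) ≟ y
... | yes refl = punchOut y≢x , λ { refl →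
      trans (cong f (punchIn-punchOut y≢x)) (trans fx≡fy (proj₂ (sur z) refl)) }
... | no  p≢y  = punchOut (p≢y ∘ sym) , λ { refl →
      trans (cong f (punchIn-punchOut (p≢y ∘ sym))) (proj₂ (sur z) refl) }

surjective⇒injective : ∀ {m n} {f : Fin m → Fin n} → m ≤ n →
                       Surjective _≡_ _≡_ f → Injective _≡_ _≡_ f
surjective⇒injective {suc m} m≤n sur {x} {y} fx≡fy with x ≟ y
... | yes x≡y = x≡y
... | no  x≢y = contradiction
      (≤-trans m≤n (surjective⇒≤ (surjective-∘-punchIn (x≢y ∘ sym) fx≡fy sur)))
      1+n≰n

≤R-antisym : H ≤R G → G ≤R H → Iso G H
≤R-antisym Φ Ψ = record
  { isoHom = hom Φ
  ; bijE   = surjective⇒injective (surjective⇒≤ (surjE Ψ)) (surjE Φ) , surjE Φ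
  ; bijV   = surjective⇒injective (surjective⇒≤ (surjV Ψ)) (surjV Φ) , surjV Φ
  }

≤S-trans : ∀ {H K G : Graph} → H ≤S K → K ≤S G → H ≤S G
≤S-trans (Φ , syncΦ) (Ψ , syncΨ) = Φ ∘ᴿ Ψ , fibresSynchronized⇒synchronizing (Φ ∘ᴿ Ψ)
  (fibresSynchronized-∘ Φ Ψ (synchronizing⇒fibresSynchronized Φ syncΦ)
                            (synchronizing⇒fibresSynchronized Ψ syncΨ))

corollary3p10 :
    (∀ {H K G : Graph} → H ≤S K → K ≤S G → H ≤S G)
    × (∀ (G : Graph) → G ≤S G)
    × (∀ {G H : Graph} → H ≤S G → G ≤S H → Iso G H)
    × (∀ {G G' H H' : Graph} → Iso G G' → Iso H H' → H ≤S G → H' ≤S G')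
    × (∀ {G H : Graph} → H ≤S G → H ≤R G)
corollary3p10 =
    ≤S-trans
  , Iso⇒≤S ∘ Iso-refl
  , (λ H≤G G≤H → ≤R-antisym (proj₁ H≤G) (proj₁ G≤H))
  , (λ G≅G′ H≅H′ H≤G → ≤S-trans (Iso⇒≤S H≅H′) (≤S-trans H≤G (Iso⇒≤S (Iso-sym G≅G′))))
  , proj₁
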